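{- Let $G$ be a finite simple connected graph on $n$ vertices and let $\alpha\in[0,1)$ be rational, with $\det\tilde W_\alpha(G)\neq 0$. If $U\in\Gamma_\alpha(G)$ has level $l$, then $l\mid s_n$, where $s_n$ is the $n$-th (largest) elementary divisor of $\tilde W_\alpha(G)$, i.e. the last diagonal entry of its Smith normal form $\mathrm{diag}(s_1,\dots,s_n)$ with $s_i\mid s_{i+1}$.
   Context: For a graph $G$ on $n$ vertices, $A(G)$ is its adjacency matrix, $D(G)$ its diagonal degree matrix, $A_\alpha(G)=\alpha D(G)+(1-\alpha)A(G)$. For rational $\alpha\in[0,1)$, $c_\alpha$ is the smallest positive integer such that $c_\alpha\alpha$ and $c_\alpha(1-\alpha)$ are integers, and $A_{c_\alpha}(G)=c_\alpha A_\alpha(G)$. $\mathbf 1$ is the all-ones vector and $\tilde W_\alpha(G)=\left[\mathbf 1,\frac{A_{c_\alpha}(G)\mathbf 1}{c_\alpha},\dots,\frac{A_{c_\alpha}(G)^{n-1}\mathbf 1}{c_\alpha}\right]$ (an integral matrix). $O_n(\mathbb Q)$ is the set of $n\times n$ rational orthogonal matrices and $\Gamma_\alpha(G)=\{U\in O_n(\mathbb Q): U\mathbf 1=\mathbf 1,\ U^TA_{c_\alpha}(G)U=A_{c_\alpha}(H)\text{ for some graph }H\}$ (graphs are finite, simple, undirected). The level of a rational orthogonal matrix $U$ is the smallest positive integer $k$ such that $kU$ is integral. -}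

module Defs where

open import Data.Nat as ℕ using (ℕ; zero; suc)
open import Data.Integer as ℤ using (ℤ; +_)
open import Data.Rational as ℚ using (ℚ; 0ℚ; 1ℚ; _+_; _*_; _-_; _≤_; _<_; _/_)
open import Data.Fin using (Fin; zero; suc; punchIn; fromℕ)
open import Data.Bool using (Bool; true; false; if_then_else_)
open import Data.Product using (Σ; ∃; _×_; _,_)
open import Relation.Binary.PropositionalEquality using (_≡_; _≢_)
open import Relation.Nullary using (¬_)
open import Data.Integer.Divisibility using () renaming (_∣_ to _∣ℤ_)
import Data.Fin

record Graph (n : ℕ) : Set where
  field
    adj     : Fin n → Fin n → Bool
    symm    : ∀ i j → adj i j ≡ adj j i
    irrefl  : ∀ i → adj i i ≡ false
open Graph public

data Reachable {n : ℕ} (G : Graph n) : Fin n → Fin n → Set where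
  here : ∀ {u} → Reachable G u u
  step : ∀ {u v w} → adj G u v ≡ true → Reachable G v w → Reachable G u w

Connected : ∀ {n} → Graph n → Set
Connected {n} G = ∀ (u v : Fin n) → Reachable G u v

Matrix : ℕ → Set
Matrix n = Fin n → Fin n → ℚ

Vector : ℕ → Set
Vector n = Fin n → ℚ

∑ : ∀ {n} → (Fin n → ℚ) → ℚ
∑ {zero}  f = 0ℚ
∑ {suc n} f = f zero + ∑ (λ i → f (suc i))

_⊗_ : ∀ {n} → Matrix n → Matrix n → Matrix n
(M ⊗ N) i j = ∑ (λ k → M i k * N k j)

_·v_ : ∀ {n} → Matrix n → Vector n → Vector n
(M ·v v) i = ∑ (λ k → M i k * v k)

transpose : ∀ {n} → Matrix n → Matrix n
transpose M i j = M j i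

δ : ∀ {n} → Fin n → Fin n → ℚ
δ zero    zero    = 1ℚ
δ zero    (suc j) = 0ℚ
δ (suc i) zero    = 0ℚ
δ (suc i) (suc j) = δ i j

idM : ∀ {n} → Matrix n
idM = δ

ones : ∀ {n} → Vector n
ones _ = 1ℚ

_^v_·_ : ∀ {n} → Matrix n → ℕ → Vector n → Vector n
M ^v zero  · v = v
M ^v suc k · v = M ·v (M ^v k · v)

det : ∀ {n} → Matrix n → ℚ
det {zero}  M = 1ℚ
det {suc n} M = ∑ (λ j → sign (Data.Fin.toℕ j) * (M zero j * det (minor j)))
  where
  minor : Fin (suc n) → Matrix n
  minor j r c = M (suc r) (punchIn j c)
  sign : ℕ → ℚ
  sign zero          = 1ℚ
  sign (suc zero)    = ℚ.- 1ℚ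
  sign (suc (suc k)) = sign k

fromℤ : ℤ → ℚ
fromℤ z = z / 1

IsIntegral : ℚ → Set
IsIntegral q = ℚ.denominatorℕ q ≡ 1

IntegralMatrix : ∀ {n} → Matrix n → Set
IntegralMatrix M = ∀ i j → IsIntegral (M i j)

toℚM : ∀ {n} → (Fin n → Fin n → ℤ) → Matrix n
toℚM P i j = fromℤ (P i j)

Unimodular : ∀ {n} → (Fin n → Fin n → ℤ) → Set
Unimodular {n} P = Σ (Fin n → Fin n → ℤ) λ Q →
  (toℚM P ⊗ toℚM Q ≡ idM) × (toℚM Q ⊗ toℚM P ≡ idM)

diag : ∀ {n} → (Fin n → ℤ) → Matrix n
diag s i j = fromℤ (s i) * δ i j

IsSmithNormalFormOf : ∀ {n} → (Fin n → ℤ) → Matrix n → Set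
IsSmithNormalFormOf {n} s M =
  Σ (Fin n → Fin n → ℤ) λ P → Σ (Fin n → Fin n → ℤ) λ Q →
    Unimodular P × Unimodular Q ×
    ((toℚM P ⊗ M) ⊗ toℚM Q ≡ diag s) ×
    (∀ (i : Fin n) (j : Fin n) → Data.Fin.toℕ j ≡ suc (Data.Fin.toℕ i) → s i ∣ℤ s j)

fromℕℚ : ℕ → ℚ
fromℕℚ k = (+ k) / 1

-- 1/c (c ≥ 1 whenever used; the c = 0 clause is an unused default)
invℕ : ℕ → ℚ
invℕ zero    = 0ℚ
invℕ (suc k) = (+ 1) / suc k

IsCα : ℚ → ℕ → Set
IsCα α c = (1 ℕ.≤ c) × IsIntegral (fromℕℚ c * α) × IsIntegral (fromℕℚ c * (1ℚ - α))
         × (∀ k → 1 ℕ.≤ k → IsIntegral (fromℕℚ k * α) → IsIntegral (fromℕℚ k * (1ℚ - α)) → c ℕ.≤ k)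

adjM : ∀ {n} → Graph n → Matrix n
adjM G i j = if adj G i j then 1ℚ else 0ℚ

deg : ∀ {n} → Graph n → Fin n → ℚ
deg G i = ∑ (λ j → adjM G i j)

degM : ∀ {n} → Graph n → Matrix n
degM G i j = deg G i * δ i j

Aα : ∀ {n} → ℚ → Graph n → Matrix n
Aα α G i j = α * degM G i j + (1ℚ - α) * adjM G i j

Ac : ∀ {n} → ℚ → ℕ → Graph n → Matrix n
Ac α c G i j = fromℕℚ c * Aα α G i j

-- W̃_α(G) = [1, A_c 1 / c, …, A_c^{n-1} 1 / c]; column k is the k-th vector
W̃ : ∀ {n} → ℚ → ℕ → Graph n → Matrix n
W̃ α c G i zero    = 1ℚ
W̃ α c G i (suc k) = (Ac α c G ^v suc (Data.Fin.toℕ k) · ones) i * invℕ c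

Orthogonal : ∀ {n} → Matrix n → Set
Orthogonal U = (transpose U ⊗ U ≡ idM) × (U ⊗ transpose U ≡ idM)

InΓ : ∀ {n} → ℚ → ℕ → Graph n → Matrix n → Set
InΓ {n} α c G U = Orthogonal U × (U ·v ones ≡ ones) ×
  Σ (Graph n) λ H → (transpose U ⊗ Ac α c G) ⊗ U ≡ Ac α c H

scaleM : ∀ {n} → ℕ → Matrix n → Matrix n
scaleM k U i j = fromℕℚ k * U i j

IsLevel : ∀ {n} → Matrix n → ℕ → Set
IsLevel U l = (1 ℕ.≤ l) × IntegralMatrix (scaleM l U)
            × (∀ k → 1 ℕ.≤ k → IntegralMatrix (scaleM k U) → l ℕ.≤ k)

-- If U ∈ Γ_α(G) carries A_c(G) to A_c(H), then Uᵀ sends every walk vector A_c(G)^k 1 to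
-- A_c(H)^k 1, so Uᵀ W̃_α(G) = W̃_α(H), which is integral because the row sums of A_c(H)
-- are c times the (integral) degrees. Writing W̃_α(G) = P⁻¹ diag(s) Q⁻¹ with P, Q unimodular,
-- the matrix Y = Uᵀ P⁻¹ satisfies Y diag(s) = W̃_α(H) Q, so s_j times column j of Y is
-- integral; as every s_j divides s_n, s_n Y and hence s_n Uᵀ = (s_n Y) P are integral.
-- The level l, being the least such multiplier, then divides s_n.
module Submission where

open import Defs
open import Data.Nat as ℕ using (ℕ; zero; suc; s≤s; z≤n)
import Data.Nat.Properties as ℕP
import Data.Nat.Divisibility as ℕD
import Data.Nat.Coprimality as Coprime
open import Data.Nat.DivMod using (_%_; _/_; m≡m%n+[m/n]*n; m%n<n)
open import Data.Integer as ℤ using (ℤ; +_; -[1+_])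
import Data.Integer.Properties as ℤP
open import Data.Integer.Divisibility using (_∣_)
open import Data.Rational as ℚ using (ℚ; mkℚ; 0ℚ; 1ℚ; _+_; _*_; _-_; -_; _≤_; _<_)
import Data.Rational.Properties as ℚP
open import Data.Rational.Solver using (module +-*-Solver)
open import Algebra.Bundles using (CommutativeRing)
import Algebra.Properties.Semiring.Sum as SemiringSum
open import Data.Fin using (Fin; zero; suc; fromℕ; toℕ)
open import Data.Bool using (true; false)
open import Data.Product using (Σ; _,_)
open import Function using (_∘_)
open import Level using (0ℓ)
open import Relation.Binary.Bundles using (Setoid)
open import Relation.Binary.Core using (Rel)
open import Relation.Binary.Definitions using (Reflexive; Transitive)
open import Relation.Binary.PropositionalEquality
open import Relation.Nullary using (contradiction)
import Relation.Binary.Reasoning.Setoid as SetoidReasoning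

open +-*-Solver

IsInteger : ℚ → Set
IsInteger q = Σ ℤ λ z → q ≡ fromℤ z

fromℤ-normal : ∀ z → fromℤ z ≡ mkℚ z 0 (Coprime.sym (Coprime.1-coprimeTo _))
fromℤ-normal z = ℚP.fromℚᵘ-toℚᵘ (mkℚ z 0 (Coprime.sym (Coprime.1-coprimeTo _)))

fromℤ-homo-+ : ∀ a b → fromℤ a + fromℤ b ≡ fromℤ (a ℤ.+ b)
fromℤ-homo-+ a b rewrite fromℤ-normal a | fromℤ-normal b =
  cong (ℚ._/ 1) (cong₂ ℤ._+_ (ℤP.*-identityʳ a) (ℤP.*-identityʳ b))

fromℤ-homo-* : ∀ a b → fromℤ a * fromℤ b ≡ fromℤ (a ℤ.* b)
fromℤ-homo-* a b rewrite fromℤ-normal a | fromℤ-normal b = refl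

fromℕℚ-homo-+ : ∀ a b → fromℕℚ (a ℕ.+ b) ≡ fromℕℚ a + fromℕℚ b
fromℕℚ-homo-+ a b = sym (fromℤ-homo-+ (+ a) (+ b))

fromℕℚ-homo-* : ∀ a b → fromℕℚ (a ℕ.* b) ≡ fromℕℚ a * fromℕℚ b
fromℕℚ-homo-* a b = trans (cong fromℤ (ℤP.pos-* a b)) (sym (fromℤ-homo-* (+ a) (+ b)))

fromℕℚ-*-invℕ : ∀ c → 1 ℕ.≤ c → fromℕℚ c * invℕ c ≡ 1ℚ
fromℕℚ-*-invℕ (suc c) _
  rewrite fromℤ-normal (+ suc c) | ℚP.normalize-coprime {1} {c} (Coprime.1-coprimeTo (suc c)) =
  ℚP.*-inverseʳ (mkℚ (+ suc c) 0 (Coprime.sym (Coprime.1-coprimeTo (suc c))))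

isIntegral⇒isInteger : ∀ {q} → IsIntegral q → IsInteger q
isIntegral⇒isInteger {mkℚ z 0 c} refl = z , sym (ℚP.fromℚᵘ-toℚᵘ (mkℚ z 0 c))

isInteger⇒isIntegral : ∀ {q} → IsInteger q → IsIntegral q
isInteger⇒isIntegral (z , refl) rewrite fromℤ-normal z = refl

isInteger-fromℤ : ∀ z → IsInteger (fromℤ z)
isInteger-fromℤ z = z , refl

isInteger-+ : ∀ {p q} → IsInteger p → IsInteger q → IsInteger (p + q)
isInteger-+ (a , refl) (b , refl) = a ℤ.+ b , fromℤ-homo-+ a b

isInteger-* : ∀ {p q} → IsInteger p → IsInteger q → IsInteger (p * q)
isInteger-* (a , refl) (b , refl) = a ℤ.* b , fromℤ-homo-* a b

isInteger-neg : ∀ {p} → IsInteger p → IsInteger (- p)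
isInteger-neg {p} h = subst IsInteger (solve 1 (λ x → con (- 1ℚ) :* x := :- x) refl p)
  (isInteger-* (isInteger-fromℤ -[1+ 0 ]) h)

isInteger-∑ : ∀ {n} (f : Fin n → ℚ) → (∀ i → IsInteger (f i)) → IsInteger (∑ f)
isInteger-∑ {zero}  f h = isInteger-fromℤ (+ 0)
isInteger-∑ {suc n} f h = isInteger-+ (h zero) (isInteger-∑ (f ∘ suc) (h ∘ suc))

isInteger-∣-* : ∀ z {K} x → ℤ.∣ z ∣ ℕD.∣ K → IsInteger (fromℤ z * x) → IsInteger (fromℕℚ K * x)
isInteger-∣-* z {K} x (ℕD.divides q refl) h =
  subst IsInteger (trans (solve 3 (λ q a x → q :* (a :* x) := (q :* a) :* x) refl (fromℕℚ q) (fromℕℚ ℤ.∣ z ∣) x)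
                         (cong (_* x) (sym (fromℕℚ-homo-* q ℤ.∣ z ∣))))
        (isInteger-* (isInteger-fromℤ (+ q)) (unsigned z h))
  where
  -- fromℤ -[1+ n ] reduces to - fromℕℚ (suc n)
  unsigned : ∀ z → IsInteger (fromℤ z * x) → IsInteger (fromℕℚ ℤ.∣ z ∣ * x)
  unsigned (+ n)    h = h
  unsigned -[1+ n ] h =
    subst IsInteger (solve 2 (λ a x → :- ((:- a) :* x) := a :* x) refl (fromℕℚ (suc n)) x)
          (isInteger-neg h)

isInteger-scale-remainder : ∀ r q b x → IsInteger (fromℕℚ (r ℕ.+ q ℕ.* b) * x) →
                            IsInteger (fromℕℚ b * x) → IsInteger (fromℕℚ r * x)
isInteger-scale-remainder r q b x hK hb =
  subst IsInteger eq (isInteger-+ hK (isInteger-neg (isInteger-* (isInteger-fromℤ (+ q)) hb)))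
  where
  eq : fromℕℚ (r ℕ.+ q ℕ.* b) * x + - (fromℕℚ q * (fromℕℚ b * x)) ≡ fromℕℚ r * x
  eq rewrite fromℕℚ-homo-+ r (q ℕ.* b) | fromℕℚ-homo-* q b =
    solve 4 (λ r q b x → (r :+ q :* b) :* x :+ :- (q :* (b :* x)) := r :* x) refl (fromℕℚ r) (fromℕℚ q) (fromℕℚ b) x

module Sum = SemiringSum (CommutativeRing.semiring ℚP.+-*-commutativeRing)

∑≡sum : ∀ {n} (f : Fin n → ℚ) → ∑ f ≡ Sum.sum f
∑≡sum {zero}  f = refl
∑≡sum {suc n} f = cong (_+_ (f zero)) (∑≡sum (f ∘ suc))

∑-cong : ∀ {n} {f g : Fin n → ℚ} → (∀ i → f i ≡ g i) → ∑ f ≡ ∑ g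
∑-cong {f = f} {g} f≗g = trans (∑≡sum f) (trans (Sum.sum-cong-≗ f≗g) (sym (∑≡sum g)))

∑-distrib-+ : ∀ {n} (f g : Fin n → ℚ) → ∑ (λ i → f i + g i) ≡ ∑ f + ∑ g
∑-distrib-+ f g = begin
  ∑ (λ i → f i + g i)          ≡⟨ ∑≡sum (λ i → f i + g i) ⟩
  Sum.sum (λ i → f i + g i)    ≡⟨ Sum.∑-distrib-+ f g ⟩
  Sum.sum f + Sum.sum g        ≡⟨ sym (cong₂ _+_ (∑≡sum f) (∑≡sum g)) ⟩
  ∑ f + ∑ g                    ∎
  where open ≡-Reasoning

*-distribˡ-∑ : ∀ {n} a (f : Fin n → ℚ) → a * ∑ f ≡ ∑ (λ i → a * f i)
*-distribˡ-∑ a f = begin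
  a * ∑ f                 ≡⟨ cong (a *_) (∑≡sum f) ⟩
  a * Sum.sum f           ≡⟨ Sum.*-distribˡ-sum a f ⟩
  Sum.sum (λ i → a * f i) ≡⟨ sym (∑≡sum (λ i → a * f i)) ⟩
  ∑ (λ i → a * f i)       ∎
  where open ≡-Reasoning

*-distribʳ-∑ : ∀ {n} a (f : Fin n → ℚ) → ∑ f * a ≡ ∑ (λ i → f i * a)
*-distribʳ-∑ a f = begin
  ∑ f * a                 ≡⟨ cong (_* a) (∑≡sum f) ⟩
  Sum.sum f * a           ≡⟨ Sum.*-distribʳ-sum a f ⟩
  Sum.sum (λ i → f i * a) ≡⟨ sym (∑≡sum (λ i → f i * a)) ⟩
  ∑ (λ i → f i * a)       ∎
  where open ≡-Reasoning

∑-comm : ∀ {m n} (f : Fin m → Fin n → ℚ) → ∑ (λ i → ∑ (f i)) ≡ ∑ (λ j → ∑ (λ i → f i j))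
∑-comm f = begin
  ∑ (λ i → ∑ (f i))                     ≡⟨ ∑≡sum (λ i → ∑ (f i)) ⟩
  Sum.sum (λ i → ∑ (f i))               ≡⟨ Sum.sum-cong-≗ (λ i → ∑≡sum (f i)) ⟩
  Sum.sum (λ i → Sum.sum (f i))         ≡⟨ Sum.∑-comm f ⟩
  Sum.sum (λ j → Sum.sum (λ i → f i j)) ≡⟨ Sum.sum-cong-≗ (λ j → sym (∑≡sum (λ i → f i j))) ⟩
  Sum.sum (λ j → ∑ (λ i → f i j))       ≡⟨ sym (∑≡sum (λ j → ∑ (λ i → f i j))) ⟩
  ∑ (λ j → ∑ (λ i → f i j))             ∎
  where open ≡-Reasoning

∑-δˡ : ∀ {n} (i : Fin n) (v : Fin n → ℚ) → ∑ (λ k → δ i k * v k) ≡ v i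
∑-δˡ {suc n} zero v = begin
  1ℚ * v zero + ∑ (λ k → 0ℚ * v (suc k)) ≡⟨ cong (_+_ (1ℚ * v zero)) (*-distribˡ-∑ 0ℚ (v ∘ suc)) ⟨
  1ℚ * v zero + 0ℚ * ∑ (v ∘ suc)         ≡⟨ solve 2 (λ x y → con 1ℚ :* x :+ con 0ℚ :* y := x) refl (v zero) (∑ (v ∘ suc)) ⟩
  v zero                                 ∎
  where open ≡-Reasoning
∑-δˡ {suc n} (suc i) v = begin
  0ℚ * v zero + ∑ (λ k → δ i k * v (suc k)) ≡⟨ cong (_+_ (0ℚ * v zero)) (∑-δˡ i (v ∘ suc)) ⟩
  0ℚ * v zero + v (suc i)                   ≡⟨ solve 2 (λ x y → con 0ℚ :* x :+ y := y) refl (v zero) (v (suc i)) ⟩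
  v (suc i)                                 ∎
  where open ≡-Reasoning

δ-sym : ∀ {n} (i j : Fin n) → δ i j ≡ δ j i
δ-sym zero    zero    = refl
δ-sym zero    (suc j) = refl
δ-sym (suc i) zero    = refl
δ-sym (suc i) (suc j) = δ-sym i j

∑-δʳ : ∀ {n} (j : Fin n) (v : Fin n → ℚ) → ∑ (λ k → v k * δ k j) ≡ v j
∑-δʳ j v = trans (∑-cong (λ k → trans (ℚP.*-comm (v k) (δ k j)) (cong (_* v k) (δ-sym k j))))
                  (∑-δˡ j v)

∑-reassoc : ∀ {n} (a : Fin n → ℚ) (b : Fin n → Fin n → ℚ) (c : Fin n → ℚ) →
            ∑ (λ k → ∑ (λ l → a l * b l k) * c k) ≡ ∑ (λ l → a l * ∑ (λ k → b l k * c k))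
∑-reassoc a b c = begin
  ∑ (λ k → ∑ (λ l → a l * b l k) * c k)   ≡⟨ ∑-cong (λ k → *-distribʳ-∑ (c k) (λ l → a l * b l k)) ⟩
  ∑ (λ k → ∑ (λ l → a l * b l k * c k))   ≡⟨ ∑-comm (λ k l → a l * b l k * c k) ⟩
  ∑ (λ l → ∑ (λ k → a l * b l k * c k))   ≡⟨ ∑-cong (λ l → ∑-cong (λ k → ℚP.*-assoc (a l) (b l k) (c k))) ⟩
  ∑ (λ l → ∑ (λ k → a l * (b l k * c k))) ≡⟨ ∑-cong (λ l → *-distribˡ-∑ (a l) (λ k → b l k * c k)) ⟨
  ∑ (λ l → a l * ∑ (λ k → b l k * c k))   ∎
  where open ≡-Reasoning

infix 4 _≈_

_≈_ : ∀ {n} → Rel (Matrix n) 0ℓ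
M ≈ N = ∀ i j → M i j ≡ N i j

≈-setoid : ℕ → Setoid 0ℓ 0ℓ
≈-setoid n = record
  { Carrier       = Matrix n
  ; _≈_           = _≈_
  ; isEquivalence = record
    { refl  = λ i j → refl
    ; sym   = λ M≈N i j → sym (M≈N i j)
    ; trans = λ M≈N N≈K i j → trans (M≈N i j) (N≈K i j)
    }
  }

module ≈-Reasoning {n : ℕ} = SetoidReasoning (≈-setoid n)

≡⇒≈ : ∀ {n} {M N : Matrix n} → M ≡ N → M ≈ N
≡⇒≈ refl i j = refl

⊗-cong : ∀ {n} {M M′ N N′ : Matrix n} → M ≈ M′ → N ≈ N′ → M ⊗ N ≈ M′ ⊗ N′
⊗-cong M≈M′ N≈N′ i j = ∑-cong (λ k → cong₂ _*_ (M≈M′ i k) (N≈N′ k j))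

⊗-congˡ : ∀ {n} (M : Matrix n) {N N′ : Matrix n} → N ≈ N′ → M ⊗ N ≈ M ⊗ N′
⊗-congˡ M = ⊗-cong {M = M} (λ i j → refl)

⊗-assoc : ∀ {n} (M N K : Matrix n) → (M ⊗ N) ⊗ K ≈ M ⊗ (N ⊗ K)
⊗-assoc M N K i j = ∑-reassoc (M i) N (λ k → K k j)

⊗-identityˡ : ∀ {n} (M : Matrix n) → idM ⊗ M ≈ M
⊗-identityˡ M i j = ∑-δˡ i (λ k → M k j)

⊗-identityʳ : ∀ {n} (M : Matrix n) → M ⊗ idM ≈ M
⊗-identityʳ M i j = ∑-δʳ j (M i)

⊗-diag : ∀ {n} (M : Matrix n) (s : Fin n → ℤ) i j → (M ⊗ diag s) i j ≡ fromℤ (s j) * M i j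
⊗-diag M s i j = begin
  ∑ (λ k → M i k * (fromℤ (s k) * δ k j))   ≡⟨ ∑-cong (λ k → solve 3 (λ m a d → m :* (a :* d) := (a :* m) :* d)
                                                                    refl (M i k) (fromℤ (s k)) (δ k j)) ⟩
  ∑ (λ k → (fromℤ (s k) * M i k) * δ k j)   ≡⟨ ∑-δʳ j (λ k → fromℤ (s k) * M i k) ⟩
  fromℤ (s j) * M i j                       ∎
  where open ≡-Reasoning

scaleM-⊗ : ∀ {n} K (M N : Matrix n) → scaleM K (M ⊗ N) ≈ scaleM K M ⊗ N
scaleM-⊗ K M N i j = trans (*-distribˡ-∑ (fromℕℚ K) (λ k → M i k * N k j))
                           (∑-cong (λ k → sym (ℚP.*-assoc (fromℕℚ K) (M i k) (N k j))))

·v-cong : ∀ {n} {M M′ : Matrix n} {v w : Vector n} → M ≈ M′ → (∀ i → v i ≡ w i) →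
          ∀ i → (M ·v v) i ≡ (M′ ·v w) i
·v-cong M≈M′ v≗w i = ∑-cong (λ k → cong₂ _*_ (M≈M′ i k) (v≗w k))

·v-congˡ : ∀ {n} (M : Matrix n) {v w : Vector n} → (∀ i → v i ≡ w i) → ∀ i → (M ·v v) i ≡ (M ·v w) i
·v-congˡ M = ·v-cong {M = M} (λ i j → refl)

·v-assoc : ∀ {n} (M N : Matrix n) (v : Vector n) i → ((M ⊗ N) ·v v) i ≡ (M ·v (N ·v v)) i
·v-assoc M N v i = ∑-reassoc (M i) N v

·v-identityˡ : ∀ {n} (v : Vector n) i → (idM ·v v) i ≡ v i
·v-identityˡ v i = ∑-δˡ i v

·v-scale : ∀ {n} (M : Matrix n) a (v : Vector n) i → (M ·v (λ j → a * v j)) i ≡ a * (M ·v v) i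
·v-scale M a v i = trans (∑-cong (λ k → solve 3 (λ m a x → m :* (a :* x) := a :* (m :* x)) refl (M i k) a (v k)))
                         (sym (*-distribˡ-∑ a (λ k → M i k * v k)))

·v-inverse : ∀ {n} (M N : Matrix n) → M ⊗ N ≈ idM → ∀ v i → (M ·v (N ·v v)) i ≡ v i
·v-inverse M N MN≈I v i = begin
  (M ·v (N ·v v)) i  ≡⟨ ·v-assoc M N v i ⟨
  ((M ⊗ N) ·v v) i   ≡⟨ ·v-cong MN≈I (λ _ → refl) i ⟩
  (idM ·v v) i       ≡⟨ ·v-identityˡ v i ⟩
  v i                ∎
  where open ≡-Reasoning

·v-fixed-by-left-inverse : ∀ {n} {U V : Matrix n} {v : Vector n} → V ⊗ U ≈ idM →
                           (∀ i → (U ·v v) i ≡ v i) → ∀ i → (V ·v v) i ≡ v i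
·v-fixed-by-left-inverse {U = U} {V} {v} VU≈I Uv≗v i =
  trans (sym (·v-congˡ V Uv≗v i)) (·v-inverse V U VU≈I v i)

IntegerMatrix : ∀ {n} → Matrix n → Set
IntegerMatrix M = ∀ i j → IsInteger (M i j)

toℚM-integer : ∀ {n} (P : Fin n → Fin n → ℤ) → IntegerMatrix (toℚM P)
toℚM-integer P i j = isInteger-fromℤ (P i j)

⊗-integer : ∀ {n} {M N : Matrix n} → IntegerMatrix M → IntegerMatrix N → IntegerMatrix (M ⊗ N)
⊗-integer hM hN i j = isInteger-∑ _ (λ k → isInteger-* (hM i k) (hN k j))

^v-integer : ∀ {n} {M : Matrix n} {v : Vector n} → IntegerMatrix M → (∀ i → IsInteger (v i)) →
             ∀ k i → IsInteger ((M ^v k · v) i)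
^v-integer hM hv zero    i = hv i
^v-integer hM hv (suc k) i = isInteger-∑ _ (λ j → isInteger-* (hM i j) (^v-integer hM hv k j))

δ-integer : ∀ {n} (i j : Fin n) → IsInteger (δ i j)
δ-integer zero    zero    = isInteger-fromℤ (+ 1)
δ-integer zero    (suc j) = isInteger-fromℤ (+ 0)
δ-integer (suc i) zero    = isInteger-fromℤ (+ 0)
δ-integer (suc i) (suc j) = δ-integer i j

adjM-integer : ∀ {n} (G : Graph n) → IntegerMatrix (adjM G)
adjM-integer G i j with adj G i j
... | true  = isInteger-fromℤ (+ 1)
... | false = isInteger-fromℤ (+ 0)

deg-integer : ∀ {n} (G : Graph n) i → IsInteger (deg G i)
deg-integer G i = isInteger-∑ _ (adjM-integer G i)

Ac-integer : ∀ {n} α c (G : Graph n) → IsIntegral (fromℕℚ c * α) → IsIntegral (fromℕℚ c * (1ℚ - α)) →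
             IntegerMatrix (Ac α c G)
Ac-integer α c G cα c[1-α] i j = subst IsInteger (solve 5 (λ c a d e x →
    (c :* a) :* (d :* e) :+ (c :* (con 1ℚ :- a)) :* x := c :* (a :* (d :* e) :+ (con 1ℚ :- a) :* x))
    refl (fromℕℚ c) α (deg G i) (δ i j) (adjM G i j))
  (isInteger-+ (isInteger-* (isIntegral⇒isInteger {fromℕℚ c * α} cα) (isInteger-* (deg-integer G i) (δ-integer i j)))
               (isInteger-* (isIntegral⇒isInteger {fromℕℚ c * (1ℚ - α)} c[1-α]) (adjM-integer G i j)))

Aα-row-sum : ∀ {n} α (G : Graph n) i → (Aα α G ·v ones) i ≡ deg G i
Aα-row-sum α G i = begin
  ∑ (λ j → (α * (deg G i * δ i j) + (1ℚ - α) * adjM G i j) * 1ℚ)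
    ≡⟨ ∑-cong (λ j → solve 4 (λ a d e x → (a :* (d :* e) :+ (con 1ℚ :- a) :* x) :* con 1ℚ
                                        := (a :* d) :* (e :* con 1ℚ) :+ (con 1ℚ :- a) :* x)
                             refl α (deg G i) (δ i j) (adjM G i j)) ⟩
  ∑ (λ j → (α * deg G i) * (δ i j * 1ℚ) + (1ℚ - α) * adjM G i j)
    ≡⟨ ∑-distrib-+ (λ j → (α * deg G i) * (δ i j * 1ℚ)) (λ j → (1ℚ - α) * adjM G i j) ⟩
  ∑ (λ j → (α * deg G i) * (δ i j * 1ℚ)) + ∑ (λ j → (1ℚ - α) * adjM G i j)
    ≡⟨ sym (cong₂ _+_ (*-distribˡ-∑ (α * deg G i) (λ j → δ i j * 1ℚ)) (*-distribˡ-∑ (1ℚ - α) (adjM G i))) ⟩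
  (α * deg G i) * ∑ (λ j → δ i j * 1ℚ) + (1ℚ - α) * deg G i
    ≡⟨ cong (λ x → (α * deg G i) * x + (1ℚ - α) * deg G i) (∑-δˡ i ones) ⟩
  (α * deg G i) * 1ℚ + (1ℚ - α) * deg G i
    ≡⟨ solve 2 (λ a d → (a :* d) :* con 1ℚ :+ (con 1ℚ :- a) :* d := d) refl α (deg G i) ⟩
  deg G i ∎
  where open ≡-Reasoning

Ac-·v : ∀ {n} α c (G : Graph n) (v : Vector n) i → (Ac α c G ·v v) i ≡ fromℕℚ c * (Aα α G ·v v) i
Ac-·v α c G v i = trans (∑-cong (λ k → ℚP.*-assoc (fromℕℚ c) (Aα α G i k) (v k)))
                        (sym (*-distribˡ-∑ (fromℕℚ c) (λ k → Aα α G i k * v k)))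

Ac-^v-suc-ones : ∀ {n} α c (G : Graph n) t i →
                 (Ac α c G ^v suc t · ones) i ≡ fromℕℚ c * (Ac α c G ^v t · deg G) i
Ac-^v-suc-ones α c G zero    i = trans (Ac-·v α c G ones i) (cong (fromℕℚ c *_) (Aα-row-sum α G i))
Ac-^v-suc-ones α c G (suc t) i = trans (·v-congˡ (Ac α c G) (Ac-^v-suc-ones α c G t) i)
                                       (·v-scale (Ac α c G) (fromℕℚ c) (Ac α c G ^v t · deg G) i)

W̃-suc : ∀ {n} α c (G : Graph (suc n)) → 1 ℕ.≤ c → ∀ i k → W̃ α c G i (suc k) ≡ (Ac α c G ^v toℕ k · deg G) i
W̃-suc α c G c≥1 i k = begin
  (Ac α c G ^v suc (toℕ k) · ones) i * invℕ c ≡⟨ cong (_* invℕ c) (Ac-^v-suc-ones α c G (toℕ k) i) ⟩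
  fromℕℚ c * x * invℕ c                       ≡⟨ solve 3 (λ c x d → c :* x :* d := x :* (c :* d)) refl
                                                         (fromℕℚ c) x (invℕ c) ⟩
  x * (fromℕℚ c * invℕ c)                     ≡⟨ cong (x *_) (fromℕℚ-*-invℕ c c≥1) ⟩
  x * 1ℚ                                      ≡⟨ ℚP.*-identityʳ x ⟩
  x                                           ∎
  where
  open ≡-Reasoning
  x = (Ac α c G ^v toℕ k · deg G) i

W̃-integer : ∀ {n} α c (G : Graph n) → IsCα α c → IntegerMatrix (W̃ α c G)
W̃-integer α c G (c≥1 , cα , c[1-α] , _) i zero    = isInteger-fromℤ (+ 1)
W̃-integer α c G (c≥1 , cα , c[1-α] , _) i (suc k) =
  subst IsInteger (sym (W̃-suc α c G c≥1 i k))
        (^v-integer (Ac-integer α c G cα c[1-α]) (deg-integer G) (toℕ k) i)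

^v-ones-conj : ∀ {n} {U A B : Matrix n} → U ⊗ transpose U ≈ idM → (∀ i → (transpose U ·v ones) i ≡ 1ℚ) →
               (transpose U ⊗ A) ⊗ U ≈ B → ∀ k i → (B ^v k · ones) i ≡ (transpose U ·v (A ^v k · ones)) i
^v-ones-conj                 UUᵀ≈I Uᵀ1≗1 UᵀAU≈B zero    i = sym (Uᵀ1≗1 i)
^v-ones-conj {U = U} {A} {B} UUᵀ≈I Uᵀ1≗1 UᵀAU≈B (suc k) i = begin
  (B ·v (B ^v k · ones)) i              ≡⟨ ·v-cong (λ i j → sym (UᵀAU≈B i j)) (^v-ones-conj UUᵀ≈I Uᵀ1≗1 UᵀAU≈B k) i ⟩
  (((Uᵀ ⊗ A) ⊗ U) ·v (Uᵀ ·v a)) i      ≡⟨ ·v-assoc (Uᵀ ⊗ A) U (Uᵀ ·v a) i ⟩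
  ((Uᵀ ⊗ A) ·v (U ·v (Uᵀ ·v a))) i     ≡⟨ ·v-congˡ (Uᵀ ⊗ A) (·v-inverse U Uᵀ UUᵀ≈I a) i ⟩
  ((Uᵀ ⊗ A) ·v a) i                     ≡⟨ ·v-assoc Uᵀ A a i ⟩
  (Uᵀ ·v (A ·v a)) i                    ∎
  where
  open ≡-Reasoning
  Uᵀ = transpose U
  a = A ^v k · ones

transpose-⊗-W̃ : ∀ {n} α c (G H : Graph n) (U : Matrix n) → Orthogonal U → U ·v ones ≡ ones →
                (transpose U ⊗ Ac α c G) ⊗ U ≡ Ac α c H → transpose U ⊗ W̃ α c G ≈ W̃ α c H
transpose-⊗-W̃ α c G H U (UᵀU≡I , UUᵀ≡I) U1≡1 UᵀAU≡B = columns
  where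
  Uᵀ = transpose U
  A = Ac α c G
  B = Ac α c H

  Uᵀ1≗1 : ∀ i → (Uᵀ ·v ones) i ≡ 1ℚ
  Uᵀ1≗1 = ·v-fixed-by-left-inverse {U = U} {Uᵀ} (≡⇒≈ UᵀU≡I) (cong-app U1≡1)

  columns : Uᵀ ⊗ W̃ α c G ≈ W̃ α c H
  columns i zero    = Uᵀ1≗1 i
  columns i (suc k) = begin
    ∑ (λ j → Uᵀ i j * (a j * invℕ c))   ≡⟨ ∑-cong (λ j → sym (ℚP.*-assoc (Uᵀ i j) (a j) (invℕ c))) ⟩
    ∑ (λ j → Uᵀ i j * a j * invℕ c)     ≡⟨ *-distribʳ-∑ (invℕ c) (λ j → Uᵀ i j * a j) ⟨
    (Uᵀ ·v a) i * invℕ c                ≡⟨ cong (_* invℕ c) (^v-ones-conj {U = U} {A} {B} (≡⇒≈ UUᵀ≡I) Uᵀ1≗1 (≡⇒≈ UᵀAU≡B)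
                                                                        (suc (toℕ k)) i) ⟨
    (B ^v suc (toℕ k) · ones) i * invℕ c ∎
    where
    open ≡-Reasoning
    a = A ^v suc (toℕ k) · ones

snf-⊗-integer⇒scaleM-integer : ∀ {n} (W X : Matrix n) (s : Fin n → ℤ) {K : ℕ} → IsSmithNormalFormOf s W →
                                (∀ j → ℤ.∣ s j ∣ ℕD.∣ K) → IntegerMatrix (X ⊗ W) → IntegerMatrix (scaleM K X)
snf-⊗-integer⇒scaleM-integer W X s {K} (P , Q , (P⁻¹ , _ , P⁻¹P≡I) , _ , PWQ≡D , _) s∣K XW-integer i j =
  subst IsInteger (sym (KX≈KY⊗P i j)) (⊗-integer KY-integer (toℚM-integer P) i j)
  where
  Y = X ⊗ toℚM P⁻¹

  Y⊗P≈X : Y ⊗ toℚM P ≈ X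
  Y⊗P≈X = begin
    (X ⊗ toℚM P⁻¹) ⊗ toℚM P  ≈⟨ ⊗-assoc X (toℚM P⁻¹) (toℚM P) ⟩
    X ⊗ (toℚM P⁻¹ ⊗ toℚM P)  ≈⟨ ⊗-congˡ X (≡⇒≈ P⁻¹P≡I) ⟩
    X ⊗ idM                  ≈⟨ ⊗-identityʳ X ⟩
    X                        ∎
    where open ≈-Reasoning

  Y⊗D≈XW⊗Q : Y ⊗ diag s ≈ (X ⊗ W) ⊗ toℚM Q
  Y⊗D≈XW⊗Q = begin
    Y ⊗ diag s                                        ≈⟨ ⊗-congˡ Y (≡⇒≈ PWQ≡D) ⟨
    Y ⊗ ((toℚM P ⊗ W) ⊗ toℚM Q)                       ≈⟨ ⊗-congˡ Y (⊗-assoc (toℚM P) W (toℚM Q)) ⟩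
    (X ⊗ toℚM P⁻¹) ⊗ (toℚM P ⊗ (W ⊗ toℚM Q))          ≈⟨ ⊗-assoc X (toℚM P⁻¹) _ ⟩
    X ⊗ (toℚM P⁻¹ ⊗ (toℚM P ⊗ (W ⊗ toℚM Q)))          ≈⟨ ⊗-congˡ X (⊗-assoc (toℚM P⁻¹) (toℚM P) _) ⟨
    X ⊗ ((toℚM P⁻¹ ⊗ toℚM P) ⊗ (W ⊗ toℚM Q))          ≈⟨ ⊗-congˡ X (⊗-cong (≡⇒≈ P⁻¹P≡I) (λ _ _ → refl)) ⟩
    X ⊗ (idM ⊗ (W ⊗ toℚM Q))                          ≈⟨ ⊗-congˡ X (⊗-identityˡ (W ⊗ toℚM Q)) ⟩
    X ⊗ (W ⊗ toℚM Q)                                  ≈⟨ ⊗-assoc X W (toℚM Q) ⟨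
    (X ⊗ W) ⊗ toℚM Q                                  ∎
    where open ≈-Reasoning

  sY-integer : ∀ i j → IsInteger (fromℤ (s j) * Y i j)
  sY-integer i j = subst IsInteger (trans (sym (Y⊗D≈XW⊗Q i j)) (⊗-diag Y s i j))
                         (⊗-integer XW-integer (toℚM-integer Q) i j)

  KY-integer : IntegerMatrix (scaleM K Y)
  KY-integer i j = isInteger-∣-* (s j) (Y i j) (s∣K j) (sY-integer i j)

  KX≈KY⊗P : scaleM K X ≈ scaleM K Y ⊗ toℚM P
  KX≈KY⊗P i j = trans (cong (fromℕℚ K *_) (sym (Y⊗P≈X i j))) (scaleM-⊗ K Y (toℚM P) i j)

module _ {a ℓ} {A : Set a} {_∼_ : Rel A ℓ} (∼-refl : Reflexive _∼_) (∼-trans : Transitive _∼_) where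

  Chain : ∀ {n} → (Fin n → A) → Set ℓ
  Chain s = ∀ i j → toℕ j ≡ suc (toℕ i) → s i ∼ s j

  chain-tail : ∀ {n} (s : Fin (suc n) → A) → Chain s → Chain (s ∘ suc)
  chain-tail s chain i j e = chain (suc i) (suc j) (cong suc e)

  chain⇒last : ∀ {m} (s : Fin (suc m) → A) → Chain s → ∀ j → s j ∼ s (fromℕ m)
  chain⇒last {zero}  s chain zero    = ∼-refl
  chain⇒last {suc m} s chain zero    =
    ∼-trans (chain zero (suc zero) refl) (chain⇒last (s ∘ suc) (chain-tail s chain) zero)
  chain⇒last {suc m} s chain (suc j) = chain⇒last (s ∘ suc) (chain-tail s chain) j

level-∣ : ∀ {n} {U : Matrix n} {l K : ℕ} → IsLevel U l → IntegralMatrix (scaleM K U) → l ℕD.∣ K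
level-∣ {l = zero} (() , _)
level-∣ {U = U} {l@(suc _)} {K} (_ , lU , minimal) KU with K % l in K%l≡r
... | zero  = ℕD.m%n≡0⇒n∣m K l K%l≡r
... | suc r = contradiction (minimal (suc r) (s≤s z≤n) rU) (ℕP.<⇒≱ (subst (ℕ._< l) K%l≡r (m%n<n K l)))
  where
  K≡r+q*l : K ≡ suc r ℕ.+ (K / l) ℕ.* l
  K≡r+q*l = trans (m≡m%n+[m/n]*n K l) (cong (ℕ._+ (K / l) ℕ.* l) K%l≡r)

  rU : IntegralMatrix (scaleM (suc r) U)
  rU i j = isInteger⇒isIntegral (isInteger-scale-remainder (suc r) (K / l) l (U i j)
             (subst (λ k → IsInteger (fromℕℚ k * U i j)) K≡r+q*l (isIntegral⇒isInteger (KU i j)))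
             (isIntegral⇒isInteger (lU i j)))

lemma3p6 : (m : ℕ) (G : Graph (suc m)) → Connected G →
           (α : ℚ) → 0ℚ ≤ α → α < 1ℚ → (c : ℕ) → IsCα α c →
           det (W̃ α c G) ≢ 0ℚ →
           (U : Matrix (suc m)) → InΓ α c G U →
           (l : ℕ) → IsLevel U l →
           (s : Fin (suc m) → ℤ) → IsSmithNormalFormOf s (W̃ α c G) →
           (+ l) ∣ s (fromℕ m)
lemma3p6 m G _ α _ _ c isCα _ U (orthogonal , U1≡1 , H , UᵀAU≡B) l level s snf@(_ , _ , _ , _ , _ , chain) =
  level-∣ level (λ i j → isInteger⇒isIntegral (sUᵀ-integer j i))
  where
  UᵀW-integer : IntegerMatrix (transpose U ⊗ W̃ α c G)
  UᵀW-integer i j = subst IsInteger (sym (transpose-⊗-W̃ α c G H U orthogonal U1≡1 UᵀAU≡B i j))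
                          (W̃-integer α c H isCα i j)

  sUᵀ-integer : IntegerMatrix (scaleM ℤ.∣ s (fromℕ m) ∣ (transpose U))
  sUᵀ-integer = snf-⊗-integer⇒scaleM-integer (W̃ α c G) (transpose U) s snf
                  (chain⇒last {_∼_ = _∣_} ℕD.∣-refl ℕD.∣-trans s chain) UᵀW-integer
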